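{- For each odd $n\geq3$, the variety $\mathbb{M}(\mathbf{z}_\infty)$ satisfies the identity $\mathbf{w}_n\approx\mathbf{w}'_n$.
   Context: Zimin words: $\mathbf{z}_0=x_0$, $\mathbf{z}_{k+1}=\mathbf{z}_kx_{k+1}\mathbf{z}_k$ with pairwise distinct letters $x_0,x_1,\dots$; $\mathbf{z}_\infty$ is their right-infinite limit. $M(\mathbf{z}_\infty)$ has elements $0$, $1$ and the finite nonempty factors of $\mathbf{z}_\infty$, with $\mathbf{u}\cdot\mathbf{v}=\mathbf{u}\mathbf{v}$ if this is a factor of $\mathbf{z}_\infty$ and $0$ otherwise ($0$ a zero, $1$ an identity); $\mathbb{M}(\mathbf{z}_\infty)$ is the monoid variety it generates. For distinct letters $x_1,\dots,x_n,y,z$, $\mathbf{w}_n=x_1yx_2z\cdots x_nyx_1zx_2y\cdots yx_n$, i.e. $x_1s_1x_2\cdots x_ns_nx_1s_{n+1}\cdots s_{2n-1}x_n$ with $s_i=y$ for odd $i$ and $z$ for even $i$; $\mathbf{w}'_n$ is obtained from $\mathbf{w}_n$ by exchanging $y$ and $z$. -}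

module Defs where

open import Data.Nat using (ℕ; zero; suc)
open import Data.Fin using (Fin)
open import Data.List using (List; []; _∷_; _++_; [_]; map; allFin)
open import Data.Maybe using (Maybe; nothing; just)
open import Data.Product using (∃; ∃-syntax)
open import Data.Unit using (⊤)
open import Relation.Nullary using (Dec; yes; no)
open import Relation.Unary using (Decidable)
open import Relation.Binary.PropositionalEquality using (_≡_)

zimin : ℕ → List ℕ
zimin zero    = [ 0 ]
zimin (suc k) = zimin k ++ [ suc k ] ++ zimin k

-- u is a (finite, possibly empty) factor of z_∞.  Since z_∞ is the limit of
-- the chain of prefixes z_0, z_1, ..., its finite factors are exactly the
-- factors of the z_k.
IsFactor : List ℕ → Set
IsFactor u = ∃[ k ] ∃[ p ] ∃[ s ] (p ++ u ++ s ≡ zimin k)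

-- Elements of M(z_∞) are represented in  Maybe (List ℕ):
--   nothing  = 0,   just []  = 1,   just u  (u a nonempty factor) = u.
Elt : Set
Elt = Maybe (List ℕ)

InM : Elt → Set
InM nothing  = ⊤
InM (just u) = IsFactor u

-- Multiplication of M(z_∞), relative to a decision procedure for IsFactor
-- (any two such procedures give the same operation).
module MZ (dec : Decidable IsFactor) where

  _·_ : Elt → Elt → Elt
  nothing · _       = nothing
  just _  · nothing = nothing
  just u  · just v with dec (u ++ v)
  ... | yes _ = just (u ++ v)
  ... | no  _ = nothing

  eval : {A : Set} → (A → Elt) → List A → Elt
  eval φ []       = just []
  eval φ (a ∷ as) = φ a · eval φ as

-- The monoid M(z_∞) (equivalently, the variety 𝕄(z_∞) it generates)
-- satisfies the identity u ≈ v over the alphabet A.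
Satisfies : {A : Set} → List A → List A → Set
Satisfies {A} u v =
  (dec : Decidable IsFactor) (φ : A → Elt) → (∀ a → InM (φ a)) →
  MZ.eval dec φ u ≡ MZ.eval dec φ v

data Letter (n : ℕ) : Set where
  x : Fin n → Letter n
  y : Letter n
  z : Letter n

sep : {n : ℕ} → ℕ → Letter n
sep zero          = z
sep (suc zero)    = y
sep (suc (suc i)) = sep i

interleave : {n : ℕ} → ℕ → List (Letter n) → List (Letter n)
interleave i []            = []
interleave i (a ∷ [])      = a ∷ []
interleave i (a ∷ b ∷ cs)  = a ∷ sep i ∷ interleave (suc i) (b ∷ cs)

-- w_n = x_1 s_1 x_2 ... x_n s_n x_1 s_{n+1} ... s_{2n-1} x_n
w : (n : ℕ) → List (Letter n)
w n = interleave 1 (map x (allFin n) ++ map x (allFin n))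

swapYZ : {n : ℕ} → Letter n → Letter n
swapYZ (x i) = x i
swapYZ y     = z
swapYZ z     = y

w′ : (n : ℕ) → List (Letter n)
w′ n = map swapYZ (w n)

-- Every nonempty factor of z_∞ contains its largest letter m exactly once: a factor of
-- z_{k+1} = z_k (k+1) z_k all of whose letters are below k+1 lies inside one copy of z_k,
-- and m occurs at most once in z_m.  If every letter occurs at least twice in u, then every
-- letter of a nonzero value of u in M(z_∞) occurs twice in it, so that value is 1 and all
-- letters are sent to 1.  Thus u and v take equal values whenever every letter occurs at
-- least twice in each of them; for n ≥ 3 this holds for w_n and w'_n whatever the parity of n.
module Submission where

open import Defs
open import Data.Nat using (ℕ; _≤_; _%_)
open import Relation.Binary.PropositionalEquality using (_≡_)

open import Data.Nat using (zero; suc; _+_; _<_; z≤n; s≤s)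
open import Data.Nat.Properties using (≤-refl; <-irrefl; <-trans; n<1+n; m≤n⇒m<n∨m≡n; _≤?_)
open import Data.List using (List; []; _∷_; _++_; map; allFin)
open import Data.List.Relation.Unary.All using (All; _∷_; lookup)
open import Data.List.Relation.Unary.Any using (here; there)
open import Data.List.Membership.Propositional using (_∈_; _∉_)
open import Data.List.Membership.Propositional.Properties using (∈-++⁻; ∈-++⁺ʳ; ∈-map⁺; ∈-allFin)
open import Data.List.Relation.Binary.Sublist.Propositional using (_⊆_; []; _∷_; _∷ʳ_; ⊆-refl)
open import Data.List.Relation.Binary.Sublist.Propositional.Properties using (++⁺; ++⁺ˡ; ++⁺ʳ; Any-resp-⊆)
open import Data.List.Extrema.Nat using (max; argmax-sel; v≤max⁺; xs≤max)
open import Data.List.Properties using (∷-injective)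
open import Data.Maybe using (nothing; just)
open import Data.Maybe.Properties using (just-injective)
open import Data.Product using (∃-syntax; _×_; _,_; proj₁; proj₂)
open import Data.Sum using (_⊎_; inj₁; inj₂)
open import Data.Empty using (⊥-elim)
open import Relation.Nullary using (¬_; yes; no)
open import Relation.Unary using (Decidable)
open import Relation.Binary.PropositionalEquality using (refl; sym; trans; cong; subst)

data Twice {A : Set} (a : A) : List A → Set where
  here  : ∀ {l} → a ∈ l → Twice a (a ∷ l)
  there : ∀ {b l} → Twice a l → Twice a (b ∷ l)

module _ {A : Set} {a : A} where

  Twice⇒∈ : ∀ {l} → Twice a l → a ∈ l
  Twice⇒∈ (here _)  = here refl
  Twice⇒∈ (there t) = there (Twice⇒∈ t)

  Twice-++⁺ : ∀ {l₁ l₂} → a ∈ l₁ → a ∈ l₂ → Twice a (l₁ ++ l₂)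
  Twice-++⁺ {_ ∷ l₁} (here refl) q = here (∈-++⁺ʳ l₁ q)
  Twice-++⁺ (there p) q            = there (Twice-++⁺ p q)

  Twice-resp-⊆ : ∀ {l₁ l₂} → l₁ ⊆ l₂ → Twice a l₁ → Twice a l₂
  Twice-resp-⊆ (_ ∷ʳ τ)   t         = there (Twice-resp-⊆ τ t)
  Twice-resp-⊆ (refl ∷ τ) (here p)  = here (Any-resp-⊆ τ p)
  Twice-resp-⊆ (_ ∷ τ)    (there t) = there (Twice-resp-⊆ τ t)

  ¬Twice-++-∷ : ∀ {l₁ l₂} → a ∉ l₁ → a ∉ l₂ → ¬ Twice a (l₁ ++ a ∷ l₂)
  ¬Twice-++-∷ {[]}     _     a∉l₂ (here p)  = a∉l₂ p
  ¬Twice-++-∷ {[]}     _     a∉l₂ (there t) = a∉l₂ (Twice⇒∈ t)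
  ¬Twice-++-∷ {_ ∷ _}  a∉l₁  _    (here p)  = a∉l₁ (here refl)
  ¬Twice-++-∷ {_ ∷ _}  a∉l₁  a∉l₂ (there t) = ¬Twice-++-∷ (λ p → a∉l₁ (there p)) a∉l₂ t

Twice-map : ∀ {A B : Set} (f : A → B) {a l} → Twice a l → Twice (f a) (map f l)
Twice-map f (here p)  = here (∈-map⁺ f p)
Twice-map f (there t) = there (Twice-map f t)

_FactorOf_ : List ℕ → List ℕ → Set
V FactorOf W = ∃[ p ] ∃[ s ] (p ++ V ++ s ≡ W)

FactorOf⇒⊆ : ∀ {V W} → V FactorOf W → V ⊆ W
FactorOf⇒⊆ {V} (p , s , refl) = ++⁺ˡ p (++⁺ʳ s ⊆-refl)

prefix-before-∉ : ∀ {c : ℕ} V {s} A {B} → c ∉ V → V ++ s ≡ A ++ c ∷ B → ∃[ s′ ] (V ++ s′ ≡ A)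
prefix-before-∉ []      A       _   _  = A , refl
prefix-before-∉ (v ∷ V) []      c∉V eq = ⊥-elim (c∉V (here (sym (proj₁ (∷-injective eq)))))
prefix-before-∉ (v ∷ V) (a ∷ A) c∉V eq with ∷-injective eq
... | refl , eq′ with prefix-before-∉ V A (λ p → c∉V (there p)) eq′
...   | s′ , e = s′ , cong (v ∷_) e

factor-++-∷-∉ : ∀ {c : ℕ} {V} A B → c ∉ V → V FactorOf (A ++ c ∷ B) → V FactorOf A ⊎ V FactorOf B
factor-++-∷-∉ A       B c∉V ([] , s , eq) with prefix-before-∉ _ A c∉V eq
... | s′ , e = inj₁ ([] , s′ , e)
factor-++-∷-∉ []      B c∉V (_ ∷ p , s , eq) = inj₂ (p , s , proj₂ (∷-injective eq))
factor-++-∷-∉ (a ∷ A) B c∉V (q ∷ p , s , eq) with ∷-injective eq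
... | refl , eq′ with factor-++-∷-∉ A B c∉V (p , s , eq′)
...   | inj₁ (p′ , s′ , e) = inj₁ (a ∷ p′ , s′ , cong (a ∷_) e)
...   | inj₂ f             = inj₂ f

∉-zimin : ∀ {m} k → k < m → m ∉ zimin k
∉-zimin zero    k<m (here refl) = <-irrefl refl k<m
∉-zimin (suc k) k<m m∈ with ∈-++⁻ (zimin k) m∈
... | inj₁ p         = ∉-zimin k (<-trans (n<1+n k) k<m) p
... | inj₂ (here refl) = <-irrefl refl k<m
... | inj₂ (there p) = ∉-zimin k (<-trans (n<1+n k) k<m) p

¬Twice-zimin : ∀ {m} k → k ≤ m → ¬ Twice m (zimin k)
¬Twice-zimin k k≤m with m≤n⇒m<n∨m≡n k≤m
... | inj₁ k<m = λ t → ∉-zimin k k<m (Twice⇒∈ t)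
¬Twice-zimin zero    _ | inj₂ refl = λ { (here ()) ; (there ()) }
¬Twice-zimin (suc k) _ | inj₂ refl = ¬Twice-++-∷ (∉-zimin k (n<1+n k)) (∉-zimin k (n<1+n k))

maximum-once-in-zimin-factor : ∀ {m V} k → V FactorOf zimin k → All (_≤ m) V → ¬ Twice m V
maximum-once-in-zimin-factor {m} k f V≤m t with k ≤? m
... | yes k≤m = ¬Twice-zimin k k≤m (Twice-resp-⊆ (FactorOf⇒⊆ f) t)
maximum-once-in-zimin-factor zero    f V≤m t | no k≰m = k≰m z≤n
maximum-once-in-zimin-factor (suc k) f V≤m t | no k≰m
  with factor-++-∷-∉ (zimin k) (zimin k) (λ p → k≰m (lookup V≤m p)) f
... | inj₁ f′ = maximum-once-in-zimin-factor k f′ V≤m t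
... | inj₂ f′ = maximum-once-in-zimin-factor k f′ V≤m t

max∈ : ∀ c V → max c V ∈ c ∷ V
max∈ c V with argmax-sel (λ n → n) c V
... | inj₁ e = subst (_∈ c ∷ V) (sym e) (here refl)
... | inj₂ p = there p

nonlinear-factor≡[] : ∀ {V} → IsFactor V → (∀ {m} → m ∈ V → Twice m V) → V ≡ []
nonlinear-factor≡[] {[]}    _           _  = refl
nonlinear-factor≡[] {c ∷ V} (k , f) nonlinear =
  ⊥-elim (maximum-once-in-zimin-factor k f (v≤max⁺ c V (inj₁ ≤-refl) ∷ xs≤max c V)
                                           (nonlinear (max∈ c V)))

data Splits {A : Set} (φ : A → Elt) : List A → List ℕ → Set where
  []  : Splits φ [] []
  _∷_ : ∀ {a u va V} → φ a ≡ just va → Splits φ u V → Splits φ (a ∷ u) (va ++ V)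

module _ {A : Set} {φ : A → Elt} where

  Splits-∈ : ∀ {u V a} → Splits φ u V → a ∈ u → ∃[ va ] (φ a ≡ just va × va ⊆ V)
  Splits-∈ (_∷_ {va = va} {V} e _) (here refl) = va , e , ++⁺ʳ V ⊆-refl
  Splits-∈ (_∷_ {va = vb} _ s)     (there p) with Splits-∈ s p
  ... | va , e , τ = va , e , ++⁺ˡ vb τ

  Splits-Twice : ∀ {u V a} → Splits φ u V → Twice a u → ∃[ va ] (φ a ≡ just va × va ++ va ⊆ V)
  Splits-Twice (_∷_ {va = va} e s) (here p) with Splits-∈ s p
  ... | vb , e′ , τ rewrite just-injective (trans (sym e) e′) = vb , e′ , ++⁺ ⊆-refl τ
  Splits-Twice (_∷_ {va = vb} _ s) (there t) with Splits-Twice s t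
  ... | va , e , τ = va , e , ++⁺ˡ vb τ

  Splits-∈⁻ : ∀ {u V m} → Splits φ u V → m ∈ V → ∃[ a ] ∃[ va ] (a ∈ u × φ a ≡ just va × m ∈ va)
  Splits-∈⁻ (_∷_ {a} {va = va} e s) p with ∈-++⁻ va p
  ... | inj₁ q = a , va , here refl , e , q
  ... | inj₂ q with Splits-∈⁻ s q
  ...   | b , vb , b∈u , e′ , q′ = b , vb , there b∈u , e′ , q′

  Splits-nonlinear : ∀ {u V} → Splits φ u V → (∀ a → Twice a u) → ∀ {m} → m ∈ V → Twice m V
  Splits-nonlinear s nonlinear m∈V with Splits-∈⁻ s m∈V
  ... | a , va , _ , e , m∈va with Splits-Twice s (nonlinear a)
  ...   | vb , e′ , τ rewrite just-injective (trans (sym e) e′) = Twice-resp-⊆ τ (Twice-++⁺ m∈va m∈va)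

[]-isFactor : IsFactor []
[]-isFactor = 0 , [] , zimin 0 , refl

module _ (dec : Decidable IsFactor) where
  open MZ dec

  eval≡just⇒Splits : ∀ {A : Set} {φ : A → Elt} u {V} → eval φ u ≡ just V → Splits φ u V × IsFactor V
  eval≡just⇒Splits []              refl = [] , []-isFactor
  eval≡just⇒Splits {φ = φ} (a ∷ u) eq with φ a in e | eval φ u in eu
  eval≡just⇒Splits (a ∷ u) () | nothing | _
  eval≡just⇒Splits (a ∷ u) () | just _  | nothing
  eval≡just⇒Splits (a ∷ u) eq | just va | just U with dec (va ++ U)
  ... | yes f with refl ← eq = e ∷ proj₁ (eval≡just⇒Splits u eu) , f
  eval≡just⇒Splits (a ∷ u) () | just va | just U | no _

  eval-1 : ∀ {A : Set} {φ : A → Elt} → (∀ a → φ a ≡ just []) → ∀ u → eval φ u ≡ just []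
  eval-1 φ≡1 []      = refl
  eval-1 φ≡1 (a ∷ u) rewrite φ≡1 a | eval-1 φ≡1 u with dec []
  ... | yes _  = refl
  ... | no ¬f  = ⊥-elim (¬f []-isFactor)

  eval-nonlinear : ∀ {A : Set} (φ : A → Elt) {u} → (∀ a → Twice a u) →
                   eval φ u ≡ nothing ⊎ (∀ a → φ a ≡ just [])
  eval-nonlinear φ {u} nonlinear with eval φ u in eu
  ... | nothing = inj₁ refl
  ... | just V with eval≡just⇒Splits u eu
  ...   | s , f with nonlinear-factor≡[] f (Splits-nonlinear s nonlinear)
  ...     | refl = inj₂ λ a → φa≡1 (Splits-∈ s (Twice⇒∈ (nonlinear a)))
    where
    φa≡1 : ∀ {a} → ∃[ va ] (φ a ≡ just va × va ⊆ []) → φ a ≡ just []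
    φa≡1 (_ , e , []) = e

satisfies-nonlinear : ∀ {A : Set} {u v : List A} →
                      (∀ a → Twice a u) → (∀ a → Twice a v) → Satisfies u v
satisfies-nonlinear {u = u} {v} u-nonlinear v-nonlinear dec φ _
  with eval-nonlinear dec φ u-nonlinear | eval-nonlinear dec φ v-nonlinear
... | inj₁ u≡0 | inj₁ v≡0 = trans u≡0 (sym v≡0)
... | inj₂ φ≡1 | _        = trans (eval-1 dec φ≡1 u) (sym (eval-1 dec φ≡1 v))
... | inj₁ _   | inj₂ φ≡1 = trans (eval-1 dec φ≡1 u) (sym (eval-1 dec φ≡1 v))

⊆-interleave : ∀ {n} i (L : List (Letter n)) → L ⊆ interleave i L
⊆-interleave i []           = []
⊆-interleave i (a ∷ [])     = refl ∷ []
⊆-interleave i (a ∷ b ∷ cs) = refl ∷ (sep i ∷ʳ ⊆-interleave (suc i) (b ∷ cs))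

-- s₁ = s₃ = y and s₂ = s₄ = z; the separator s₄ exists because 2n − 1 ≥ 5.
w-prefix : ∀ k → ∃[ a ] ∃[ b ] ∃[ c ] ∃[ d ] ∃[ rest ]
           (w (3 + k) ≡ a ∷ y ∷ b ∷ z ∷ c ∷ y ∷ d ∷ z ∷ rest)
w-prefix zero          = _ , _ , _ , _ , _ , refl
w-prefix (suc zero)    = _ , _ , _ , _ , _ , refl
w-prefix (suc (suc k)) = _ , _ , _ , _ , _ , refl

w-nonlinear : ∀ k (a : Letter (3 + k)) → Twice a (w (3 + k))
w-nonlinear k (x i) = Twice-resp-⊆ (⊆-interleave 1 (xs ++ xs)) (Twice-++⁺ x∈xs x∈xs)
  where
  xs   = map x (allFin (3 + k))
  x∈xs = ∈-map⁺ x (∈-allFin i)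
w-nonlinear k y with w-prefix k
... | _ , _ , _ , _ , _ , eq rewrite eq = there (here (there (there (there (here refl)))))
w-nonlinear k z with w-prefix k
... | _ , _ , _ , _ , _ , eq rewrite eq = there (there (there (here (there (there (there (here refl)))))))

swapYZ-involutive : ∀ {n} (a : Letter n) → swapYZ (swapYZ a) ≡ a
swapYZ-involutive (x i) = refl
swapYZ-involutive y     = refl
swapYZ-involutive z     = refl

w′-nonlinear : ∀ k (a : Letter (3 + k)) → Twice a (w′ (3 + k))
w′-nonlinear k a = subst (λ b → Twice b (w′ (3 + k))) (swapYZ-involutive a)
                         (Twice-map swapYZ (w-nonlinear k (swapYZ a)))

lemma4p5 : (n : ℕ) → 3 ≤ n → n % 2 ≡ 1 → Satisfies (w n) (w′ n)
lemma4p5 (suc (suc (suc k))) (s≤s (s≤s (s≤s _))) _ = satisfies-nonlinear (w-nonlinear k) (w′-nonlinear k)
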